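{- Let $\mathbf{A}=(A,\wedge,\vee,\neg,\bot,\top,\Diamond,@,\{s_{\mathbf{i}}\}_{\mathbf{i}\in\mathsf{NOM}})$ be an orthodox interpretation of $\mathcal{H}(@)$, let $a\in A$ and let $\mathbf{i}\in\mathsf{NOM}$. Then $@_{s_{\mathbf{i}}}a=\top$ iff $s_{\mathbf{i}}\leq a$, and $@_{s_{\mathbf{i}}}a=\bot$ iff $s_{\mathbf{i}}\leq\neg a$.
   Context: An orthodox interpretation of $\mathcal{H}(@)$ is an algebra $\mathbf{A}=(A,\wedge,\vee,\neg,\bot,\top,\Diamond,@,\{s_{\mathbf{i}}\}_{\mathbf{i}\in\mathsf{NOM}})$ where $(A,\wedge,\vee,\neg,\bot,\top,\Diamond)$ is a Boolean algebra with operator (normal and finitely additive $\Diamond$), each $s_{\mathbf{i}}\in A$ is a constant (the interpretation of the nominal $\mathbf{i}$), $@$ is a binary operator (normal and finitely additive in its second argument), written $@_{b}a$, and for all $a,b\in A$ and all $\mathbf{i},\mathbf{j}\in\mathsf{NOM}$: $@_{s_{\mathbf{i}}}(\neg a\vee b)\leq\neg@_{s_{\mathbf{i}}}a\vee@_{s_{\mathbf{i}}}b$; $\neg@_{s_{\mathbf{i}}}a=@_{s_{\mathbf{i}}}\neg a$; $@_{s_{\mathbf{i}}}@_{s_{\mathbf{j}}}a\leq@_{s_{\mathbf{j}}}a$; $@_{s_{\mathbf{i}}}s_{\mathbf{i}}=\top$; $s_{\mathbf{i}}\wedge a\leq@_{s_{\mathbf{i}}}a$; $\Diamond@_{s_{\mathbf{i}}}a\leq@_{s_{\mathbf{i}}}a$.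 -}

module Defs where

open import Level using (Level; _⊔_; suc)
open import Algebra.Lattice.Bundles using (BooleanAlgebra)

-- The Boolean algebra reduct is a stdlib BooleanAlgebra (equality is a setoid
-- equality _≈_, so ◇ and @ are required to respect it).
record OrthodoxInterpretation (c ℓ n : Level) : Set (suc (c ⊔ ℓ ⊔ n)) where
  field
    boolAlg : BooleanAlgebra c ℓ
    NOM     : Set n
  open BooleanAlgebra boolAlg public
  infix 4 _≤_
  _≤_ : Carrier → Carrier → Set ℓ
  a ≤ b = (a ∧ b) ≈ a
  field
    ◇      : Carrier → Carrier
    at     : Carrier → Carrier → Carrier     -- at b a  stands for  @_b a
    s      : NOM → Carrier
    ◇-cong : ∀ {a b} → a ≈ b → ◇ a ≈ ◇ b
    ◇-⊥    : ◇ ⊥ ≈ ⊥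
    ◇-∨    : ∀ a b → ◇ (a ∨ b) ≈ (◇ a ∨ ◇ b)
    at-cong : ∀ {b b′ a a′} → b ≈ b′ → a ≈ a′ → at b a ≈ at b′ a′
    at-⊥    : ∀ b → at b ⊥ ≈ ⊥
    at-∨    : ∀ b a a′ → at b (a ∨ a′) ≈ (at b a ∨ at b a′)
    ax1 : ∀ a b i → at (s i) (¬ a ∨ b) ≤ (¬ at (s i) a ∨ at (s i) b)
    ax2 : ∀ a i → ¬ at (s i) a ≈ at (s i) (¬ a)
    ax3 : ∀ a i j → at (s i) (at (s j) a) ≤ at (s j) a
    ax4 : ∀ i → at (s i) (s i) ≈ ⊤
    ax5 : ∀ a i → (s i ∧ a) ≤ at (s i) a
    ax6 : ∀ a i → ◇ (at (s i) a) ≤ at (s i) a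

-- Since @_{s_i} commutes with complement, @_{s_i} a = ⊤ amounts to @_{s_i} ¬a = ⊥,
-- and then s_i ∧ ¬a ≤ @_{s_i} ¬a = ⊥ forces s_i ≤ a. Conversely, if s_i ≤ a then
-- @_{s_i} a ≥ @_{s_i} s_i = ⊤ by additivity. The statement for ⊥ is the statement
-- for ⊤ applied to ¬a.
module Submission where

open import Defs
open import Level using (Level)
open import Data.Product using (_×_; _,_)
open import Function.Bundles using (_⇔_; mk⇔; module Equivalence)
open import Function.Properties.Equivalence using () renaming (trans to ⇔-trans)
open import Algebra.Lattice.Bundles using (BooleanAlgebra)
import Algebra.Lattice.Properties.BooleanAlgebra as BooleanAlgebraProperties
import Relation.Binary.Reasoning.Setoid as SetoidReasoning

module BooleanAlgebraLemmas {c ℓ : Level} (B : BooleanAlgebra c ℓ) where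
  open BooleanAlgebra B
  open BooleanAlgebraProperties B
  open SetoidReasoning setoid

  ≈⊤⇔¬≈⊥ : ∀ {x} → x ≈ ⊤ ⇔ ¬ x ≈ ⊥
  ≈⊤⇔¬≈⊥ {x} = mk⇔ (λ x≈⊤ → trans (¬-cong x≈⊤) ¬⊤≈⊥) λ ¬x≈⊥ → begin
    x     ≈⟨ sym (¬-involutive x) ⟩
    ¬ ¬ x ≈⟨ ¬-cong ¬x≈⊥ ⟩
    ¬ ⊥   ≈⟨ ¬⊥≈⊤ ⟩
    ⊤     ∎

  ≈⊥⇔¬≈⊤ : ∀ {x} → x ≈ ⊥ ⇔ ¬ x ≈ ⊤
  ≈⊥⇔¬≈⊤ {x} = mk⇔ (λ x≈⊥ → trans (¬-cong x≈⊥) ¬⊥≈⊤) λ ¬x≈⊤ → begin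
    x     ≈⟨ sym (¬-involutive x) ⟩
    ¬ ¬ x ≈⟨ ¬-cong ¬x≈⊤ ⟩
    ¬ ⊤   ≈⟨ ¬⊤≈⊥ ⟩
    ⊥     ∎

  ∧¬≈⊥⇒∧≈ : ∀ {x a} → x ∧ ¬ a ≈ ⊥ → x ∧ a ≈ x
  ∧¬≈⊥⇒∧≈ {x} {a} x∧¬a≈⊥ = begin
    x ∧ a             ≈⟨ sym (∨-identityʳ _) ⟩
    x ∧ a ∨ ⊥         ≈⟨ ∨-congˡ (sym x∧¬a≈⊥) ⟩
    x ∧ a ∨ x ∧ ¬ a   ≈⟨ sym (∧-distribˡ-∨ x a (¬ a)) ⟩
    x ∧ (a ∨ ¬ a)     ≈⟨ ∧-congˡ (∨-complementʳ a) ⟩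
    x ∧ ⊤             ≈⟨ ∧-identityʳ x ⟩
    x                 ∎

  ∧≈⇒∨≈ : ∀ {x a} → x ∧ a ≈ x → a ∨ x ≈ a
  ∧≈⇒∨≈ {x} {a} x∧a≈x = begin
    a ∨ x       ≈⟨ ∨-congˡ (sym x∧a≈x) ⟩
    a ∨ x ∧ a   ≈⟨ ∨-congˡ (∧-comm x a) ⟩
    a ∨ a ∧ x   ≈⟨ ∨-absorbs-∧ a x ⟩
    a           ∎

module OrthodoxInterpretationProperties {c ℓ n : Level} (A : OrthodoxInterpretation c ℓ n) where
  open OrthodoxInterpretation A
  open BooleanAlgebraProperties boolAlg
  open BooleanAlgebraLemmas boolAlg
  open SetoidReasoning setoid

  ¬at≈⇔at¬≈ : ∀ {x} a i → ¬ at (s i) a ≈ x ⇔ at (s i) (¬ a) ≈ x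
  ¬at≈⇔at¬≈ a i = mk⇔ (trans (sym (ax2 a i))) (trans (ax2 a i))

  at≈⊤⇔at¬≈⊥ : ∀ a i → at (s i) a ≈ ⊤ ⇔ at (s i) (¬ a) ≈ ⊥
  at≈⊤⇔at¬≈⊥ a i = ⇔-trans ≈⊤⇔¬≈⊥ (¬at≈⇔at¬≈ a i)

  at≈⊥⇔at¬≈⊤ : ∀ a i → at (s i) a ≈ ⊥ ⇔ at (s i) (¬ a) ≈ ⊤
  at≈⊥⇔at¬≈⊤ a i = ⇔-trans ≈⊥⇔¬≈⊤ (¬at≈⇔at¬≈ a i)

  at≈⊥⇒∧≈⊥ : ∀ {a} i → at (s i) a ≈ ⊥ → s i ∧ a ≈ ⊥
  at≈⊥⇒∧≈⊥ {a} i at-a≈⊥ = begin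
    s i ∧ a                 ≈⟨ sym (ax5 a i) ⟩
    (s i ∧ a) ∧ at (s i) a  ≈⟨ ∧-congˡ at-a≈⊥ ⟩
    (s i ∧ a) ∧ ⊥           ≈⟨ ∧-zeroʳ _ ⟩
    ⊥                       ∎

  ≤⇒at≈⊤ : ∀ {a} i → s i ≤ a → at (s i) a ≈ ⊤
  ≤⇒at≈⊤ {a} i sᵢ≤a = begin
    at (s i) a                   ≈⟨ at-cong refl (sym (∧≈⇒∨≈ sᵢ≤a)) ⟩
    at (s i) (a ∨ s i)           ≈⟨ at-∨ (s i) a (s i) ⟩
    at (s i) a ∨ at (s i) (s i)  ≈⟨ ∨-congˡ (ax4 i) ⟩
    at (s i) a ∨ ⊤               ≈⟨ ∨-zeroʳ _ ⟩
    ⊤                            ∎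

  at≈⊤⇔≤ : ∀ a i → at (s i) a ≈ ⊤ ⇔ s i ≤ a
  at≈⊤⇔≤ a i = mk⇔
    (λ at-a≈⊤ → ∧¬≈⊥⇒∧≈ (at≈⊥⇒∧≈⊥ i (Equivalence.to (at≈⊤⇔at¬≈⊥ a i) at-a≈⊤)))
    (≤⇒at≈⊤ i)

  at≈⊥⇔≤¬ : ∀ a i → at (s i) a ≈ ⊥ ⇔ s i ≤ ¬ a
  at≈⊥⇔≤¬ a i = ⇔-trans (at≈⊥⇔at¬≈⊤ a i) (at≈⊤⇔≤ (¬ a) i)

mainTheorem8 : ∀ {c ℓ n : Level} (A : OrthodoxInterpretation c ℓ n)
               → let open OrthodoxInterpretation A in
                 ∀ (a : Carrier) (i : NOM)
                 → ((at (s i) a ≈ ⊤) ⇔ (s i ≤ a))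
                   × ((at (s i) a ≈ ⊥) ⇔ (s i ≤ ¬ a))
mainTheorem8 A a i = at≈⊤⇔≤ a i , at≈⊥⇔≤¬ a i
  where open OrthodoxInterpretationProperties A
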